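{- Let $\mathcal{R}$ be a TRS and let $\Pi$ be a set of forbidden patterns each with flag $h$ or $b$. If a term $s$ is minimal non-$\Pi$-terminating in a context $C[\Box]_q$, then there exist a rule $l\to r$ of $\mathcal{R}$, a substitution $\sigma$, a context $C'[\Box]_q$ and a reduction sequence $$C[s]_q \overset{\not\le q}{\rightarrow}{}^*_{\Pi} C'[s']_q = C'[l\sigma]_q \overset{q}{\rightarrow}_{\Pi} C'[r\sigma]_q = C'[t]_q$$ such that $t$ contains a subterm $t|_p$ that is minimal non-$\Pi$-terminating in the context $C'[t[\Box]_p]_q$.
   Context: Positions are finite sequences of positive integers; $q\le q'$ means $q$ is a prefix of $q'$ (above or equal); $q<q'$ strictly above; $q>q'$ strictly below; parallel means incomparable. A context $C[\Box]_p$ is a term with a single hole at position $p$; $C[u]_p$ fills it with $u$. Forbidden patterns: triples $\langle t,p,\lambda\rangle$, $t$ a term, $p\in Pos(t)$, $\lambda\in\{h,b,a\}$. For a term $s$, $P_{t,p}(s)=\{o.p\mid s|_o=t\sigma$ for some substitution $\sigma$ and position $o\}$; for $\pi=\langle t,p,\lambda\rangle$, $P_\pi(s)=\{o\in Pos(s)\mid\exists q\in P_{t,p}(s):o<q\}$ if $\lambda=a$, $\{o\in Pos(s)\mid\exists q\in P_{t,p}(s):o>q\}$ if $\lambda=b$, $P_{t,p}(s)$ if $\lambda=h$. Forbidden positions of $s$ w.r.t. $\Pi$: $\bigcup_{\pi\in\Pi}P_\pi(s)$; all other positions are allowed. $s\rightarrow_\Pi t$ denotes an $\mathcal{R}$-rewrite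 step contracting a redex at a position allowed in $s$. $\overset{q}{\to}$ denotes a step at position $q$; $\overset{\not\le q}{\to}$ a step at a position $q'$ with $q'\not\le q$ (i.e. strictly below or parallel to $q$). A term $u$ is $\Pi$-terminating in context $C[\Box]_p$ if $C[u]_p$ does not admit an infinite $\Pi$-reduction sequence in which each contracted redex is at, below or parallel to $p$ and infinitely many steps are at or below $p$. A term $s$ is minimal non-$\Pi$-terminating in $C[\Box]_q$ if $s$ is not $\Pi$-terminating in $C[\Box]_q$ and every proper subterm $s|_p$ is $\Pi$-terminating in the context $C[s[\Box]_p]_q$. -}

module Defs where

open import Data.Nat using (ℕ; zero; suc; _≤_)
open import Data.List using (List; []; _∷_; _++_)
open import Data.Vec using (Vec; []; _∷_)
open import Data.Maybe using (Maybe; just; nothing)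
open import Data.Product using (Σ; ∃; ∃-syntax; _×_; _,_)
open import Data.Empty using (⊥)
open import Data.Unit using (⊤)
open import Relation.Nullary using (¬_)
open import Relation.Binary.PropositionalEquality using (_≡_; _≢_)
open import Relation.Binary.Construct.Closure.ReflexiveTransitive using (Star)

module Rewriting (F : Set) (arity : F → ℕ) (V : Set) where

  data Term : Set where
    var : V → Term
    fun : (f : F) → Vec Term (arity f) → Term

  -- Positions: finite sequences of argument indices.  Convention: the
  -- natural number i stands for the (i+1)-th argument (paper: positive integers).
  Pos : Set
  Pos = List ℕ

  mutual
    _∣_ : Term → Pos → Maybe Term
    t ∣ [] = just t
    var x ∣ (i ∷ p) = nothing
    fun f ts ∣ (i ∷ p) = argAt ts i p

    argAt : ∀ {n} → Vec Term n → ℕ → Pos → Maybe Term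
    argAt [] i p = nothing
    argAt (t ∷ ts) zero p = t ∣ p
    argAt (t ∷ ts) (suc i) p = argAt ts i p

  _∈Pos_ : Pos → Term → Set
  p ∈Pos t = ∃[ u ] (t ∣ p ≡ just u)

  -- replacement t[u]_p (identity if p ∉ Pos(t))
  mutual
    _[_]at_ : Term → Term → Pos → Term
    t [ u ]at [] = u
    var x [ u ]at (i ∷ p) = var x
    fun f ts [ u ]at (i ∷ p) = fun f (replArg ts u i p)

    replArg : ∀ {n} → Vec Term n → Term → ℕ → Pos → Vec Term n
    replArg [] u i p = []
    replArg (t ∷ ts) u zero p = (t [ u ]at p) ∷ ts
    replArg (t ∷ ts) u (suc i) p = t ∷ replArg ts u i p

  -- A context C[□]_p is represented by a term C together with a position
  -- p ∈ Pos(C); C[u]_p is  C [ u ]at p.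

  Subst : Set
  Subst = V → Term

  mutual
    _⟨_⟩ : Term → Subst → Term
    var x ⟨ σ ⟩ = σ x
    fun f ts ⟨ σ ⟩ = fun f (substArgs ts σ)

    substArgs : ∀ {n} → Vec Term n → Subst → Vec Term n
    substArgs [] σ = []
    substArgs (t ∷ ts) σ = (t ⟨ σ ⟩) ∷ substArgs ts σ

  _∈Var_ : V → Term → Set
  x ∈Var t = ∃[ p ] (t ∣ p ≡ just (var x))

  _≤P_ : Pos → Pos → Set
  q ≤P q' = ∃[ r ] (q ++ r ≡ q')

  _<P_ : Pos → Pos → Set
  q <P q' = ∃[ r ] (r ≢ [] × q ++ r ≡ q')

  Rule : Set
  Rule = Term × Term

  IsVar : Term → Set
  IsVar (var x) = ⊤
  IsVar (fun f ts) = ⊥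

  record TRS : Set₁ where
    field
      rules   : Rule → Set
      lhs-not-var : ∀ l r → rules (l , r) → ¬ IsVar l
      var-cond    : ∀ l r → rules (l , r) → ∀ x → x ∈Var r → x ∈Var l

  data Flag : Set where
    h b a : Flag

  record Pattern : Set where
    constructor ⟪_,_,_∣_⟫
    field
      pterm : Term
      ppos  : Pos
      pflag : Flag
      ppos-valid : ppos ∈Pos pterm

  InPtp : Term → Pos → Term → Pos → Set
  InPtp t p s q = ∃[ o ] ∃[ σ ] (s ∣ o ≡ just (t ⟨ σ ⟩) × q ≡ o ++ p)

  InPπ : Pattern → Term → Pos → Set
  InPπ ⟪ t , p , a ∣ _ ⟫ s o = o ∈Pos s × ∃[ q ] (InPtp t p s q × o <P q)
  InPπ ⟪ t , p , b ∣ _ ⟫ s o = o ∈Pos s × ∃[ q ] (InPtp t p s q × q <P o)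
  InPπ ⟪ t , p , h ∣ _ ⟫ s o = InPtp t p s o

  PatternSet : Set₁
  PatternSet = Pattern → Set

  Forbidden : PatternSet → Term → Pos → Set
  Forbidden Π s o = ∃[ π ] (Π π × InPπ π s o)

  Allowed : PatternSet → Term → Pos → Set
  Allowed Π s o = o ∈Pos s × ¬ Forbidden Π s o

  module _ (ℛ : TRS) (Π : PatternSet) where
    open TRS ℛ

    ΠStep : Term → Pos → Term → Set
    ΠStep s o t = Allowed Π s o ×
      ∃[ l ] ∃[ r ] ∃[ σ ] (rules (l , r) × s ∣ o ≡ just (l ⟨ σ ⟩)
                              × t ≡ s [ r ⟨ σ ⟩ ]at o)

    record InfSeqInCtx (u C : Term) (p : Pos) : Set where
      field
        seq  : ℕ → Term
        pos  : ℕ → Pos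
        start : seq 0 ≡ C [ u ]at p
        steps : ∀ i → ΠStep (seq i) (pos i) (seq (suc i))
        not-above : ∀ i → ¬ (pos i <P p)
        inf-at-below : ∀ n → ∃[ m ] (n ≤ m × p ≤P pos m)

    ΠTerminatingIn : Term → Term → Pos → Set
    ΠTerminatingIn u C p = ¬ InfSeqInCtx u C p

    MinNonΠTerminatingIn : Term → Term → Pos → Set
    MinNonΠTerminatingIn s C q =
      ¬ ΠTerminatingIn s C q ×
      (∀ p u → p ≢ [] → s ∣ p ≡ just u →
         ΠTerminatingIn u (C [ s ]at q) (q ++ p))

    ΠStepNotAbove : Pos → Term → Term → Set
    ΠStepNotAbove q s t = ∃[ q' ] (¬ (q' ≤P q) × ΠStep s q' t)

    _→Π*[≰_]_ : Term → Pos → Term → Set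
    s →Π*[≰ q ] t = Star (ΠStepNotAbove q) s t

module Submission where

-- Let s be minimal non-Π-terminating in C[□]_q and fix an infinite Π-reduction
-- I from C[s]_q that never rewrites strictly above q and infinitely often
-- rewrites at or below q.
--
--   * I must contain a step at q itself.  Otherwise every step at or below q
--     lies below some child position q.i of s.  A child hit infinitely often
--     would carry I as an infinite reduction of s|_i in context, contradicting
--     minimality; so each child is hit only finitely often, and since s has
--     finitely many children, only finitely many steps are below q at all.
--   * Take the first step at q.  The steps before it are at positions ≰ q,
--     the step itself contracts some lσ to rσ at q, and the rest of I shows
--     that rσ is non-terminating in that context.  A classical descent
--     through rσ then finds a subterm all of whose children terminate; such a
--     subterm is minimal non-terminating.
--
-- The
-- argument never inspects the flags of the patterns: Π-termination in context
-- is always evaluated on the whole term.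

open import Defs
open import Data.Nat using (ℕ; zero; suc; _+_; _∸_; _≤_; _<_)
open import Data.Nat.Properties
  using (_≟_; anyUpTo?; ≤-trans; m≤n+m; m∸n+n≡m; m+n≤o⇒m≤o∸n; n<1+n; m<n⇒m<1+n)
open import Data.Nat.Induction using (<-rec)
import Data.Nat.InfinitelyOften as Often
open import Data.List using ([]; _∷_; _++_)
open import Data.List.Properties using (++-conicalʳ; ++-conicalˡ; ++-assoc; ++-identityʳ; ≡-dec; ∷-injective)
open import Data.Vec using (Vec; []; _∷_)
open import Data.Maybe using (just)
open import Data.Product using (∃; ∃-syntax; _×_; _,_; proj₁; proj₂)
open import Data.Sum using (_⊎_; inj₁; inj₂)
open import Data.Empty using (⊥-elim)
open import Relation.Nullary using (¬_; yes; no)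
open import Relation.Unary using (Decidable)
open import Relation.Binary.PropositionalEquality
  using (_≡_; _≢_; refl; sym; trans; cong; cong₂; subst; subst₂)
open import Relation.Binary.Construct.Closure.ReflexiveTransitive using (ε; _◅_; _◅◅_)
open import Level using (0ℓ)
open import Axiom.ExcludedMiddle using (ExcludedMiddle)
open import Axiom.DoubleNegationElimination using (em⇒dne)

firstOccurrence : {P : ℕ → Set} → Decidable P →
                  ∀ k → P k → ∃ λ j → P j × (∀ i → i < j → ¬ P i)
firstOccurrence {P} P? = <-rec (λ k → P k → ∃ λ j → P j × (∀ i → i < j → ¬ P i)) search
  where
  search : ∀ k → (∀ {j} → j < k → P j → ∃ λ j′ → P j′ × (∀ i → i < j′ → ¬ P i)) →
           P k → ∃ λ j → P j × (∀ i → i < j → ¬ P i)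
  search k earlier Pk with anyUpTo? P? k
  ... | yes (j , j<k , Pj) = earlier j<k Pj
  ... | no none            = k , Pk , λ i i<k Pi → none (i , i<k , Pi)

module Lemmas (F : Set) (arity : F → ℕ) (V : Set) where
  open Rewriting F arity V

  ≤P⇒≡⊎<P : ∀ {o q} → o ≤P q → o ≡ q ⊎ o <P q
  ≤P⇒≡⊎<P {o} ([] , e)    = inj₁ (trans (sym (++-identityʳ o)) e)
  ≤P⇒≡⊎<P (x ∷ r , e)     = inj₂ (x ∷ r , (λ ()) , e)

  ≮P∧≢⇒≰P : ∀ {o q} → ¬ o <P q → o ≢ q → ¬ o ≤P q
  ≮P∧≢⇒≰P o≮q o≢q o≤q with ≤P⇒≡⊎<P o≤q
  ... | inj₁ o≡q = o≢q o≡q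
  ... | inj₂ o<q = o≮q o<q

  <P-++ : ∀ {o P} Q → o <P P → o <P (P ++ Q)
  <P-++ {o} Q (r , r≢[] , e) =
    r ++ Q , (λ r++Q≡[] → r≢[] (++-conicalˡ r Q r++Q≡[])) ,
    trans (sym (++-assoc o r Q)) (cong (_++ Q) e)

  ++-≤P : ∀ P Q {o} → (P ++ Q) ≤P o → P ≤P o
  ++-≤P P Q (r , e) = Q ++ r , trans (sym (++-assoc P Q r)) e

  <P-child⇒≤P : ∀ o q i → o <P (q ++ (i ∷ [])) → o ≤P q
  <P-child⇒≤P []      q       i _ = q , refl
  <P-child⇒≤P (j ∷ o) []      i (r , r≢[] , e) = ⊥-elim (r≢[] (++-conicalʳ o r (proj₂ (∷-injective e))))
  <P-child⇒≤P (j ∷ o) (k ∷ q) i (r , r≢[] , e) with ∷-injective e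
  ... | j≡k , rest with <P-child⇒≤P o q i (r , r≢[] , rest)
  ...   | r′ , e′ = r′ , cong₂ _∷_ j≡k e′

  mutual
    fill-self : ∀ T P u → T ∣ P ≡ just u → T [ u ]at P ≡ T
    fill-self T          []      u refl = refl
    fill-self (var x)    (i ∷ P) u ()
    fill-self (fun f ts) (i ∷ P) u e    = cong (fun f) (fill-self-args ts i P u e)

    fill-self-args : ∀ {n} (ts : Vec Term n) i P u → argAt ts i P ≡ just u → replArg ts u i P ≡ ts
    fill-self-args []       i       P u ()
    fill-self-args (t ∷ ts) zero    P u e = cong (_∷ ts) (fill-self t P u e)
    fill-self-args (t ∷ ts) (suc i) P u e = cong (t ∷_) (fill-self-args ts i P u e)

  mutual
    subterm-++ : ∀ T A B w → T ∣ A ≡ just w → T ∣ (A ++ B) ≡ w ∣ B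
    subterm-++ T          []      B w refl = refl
    subterm-++ (var x)    (i ∷ A) B w ()
    subterm-++ (fun f ts) (i ∷ A) B w e    = subterm-++-args ts i A B w e

    subterm-++-args : ∀ {n} (ts : Vec Term n) i A B w → argAt ts i A ≡ just w →
                      argAt ts i (A ++ B) ≡ w ∣ B
    subterm-++-args []       i       A B w ()
    subterm-++-args (t ∷ ts) zero    A B w e = subterm-++ t A B w e
    subterm-++-args (t ∷ ts) (suc i) A B w e = subterm-++-args ts i A B w e

  mutual
    fill-at : ∀ C q s → q ∈Pos C → (C [ s ]at q) ∣ q ≡ just s
    fill-at C          []      s _       = refl
    fill-at (var x)    (i ∷ q) s (u , ())
    fill-at (fun f ts) (i ∷ q) s q∈C     = fill-at-args ts i q s q∈C

    fill-at-args : ∀ {n} (ts : Vec Term n) i q s → (∃ λ u → argAt ts i q ≡ just u) →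
                   argAt (replArg ts s i q) i q ≡ just s
    fill-at-args []       i       q s (u , ())
    fill-at-args (t ∷ ts) zero    q s q∈t = fill-at t q s q∈t
    fill-at-args (t ∷ ts) (suc i) q s q∈t = fill-at-args ts i q s q∈t

  mutual
    ∈Pos-prefix : ∀ T A B → (A ++ B) ∈Pos T → A ∈Pos T
    ∈Pos-prefix T          []      B _          = T , refl
    ∈Pos-prefix (var x)    (i ∷ A) B (w , ())
    ∈Pos-prefix (fun f ts) (i ∷ A) B AB∈T       = ∈Pos-prefix-args ts i A B AB∈T

    ∈Pos-prefix-args : ∀ {n} (ts : Vec Term n) i A B → (∃ λ w → argAt ts i (A ++ B) ≡ just w) →
                       ∃ λ w → argAt ts i A ≡ just w
    ∈Pos-prefix-args []       i       A B (w , ())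
    ∈Pos-prefix-args (t ∷ ts) zero    A B AB∈t = ∈Pos-prefix t A B AB∈t
    ∈Pos-prefix-args (t ∷ ts) (suc i) A B AB∈t = ∈Pos-prefix-args ts i A B AB∈t

  mutual
    ∈Pos-replace : ∀ T o v P → o ∈Pos T → ¬ (o <P P) → P ∈Pos (T [ v ]at o) → P ∈Pos T
    ∈Pos-replace T          o       v []      _   _   _ = T , refl
    ∈Pos-replace T          []      v (j ∷ P) _   o≮P _ = ⊥-elim (o≮P (j ∷ P , (λ ()) , refl))
    ∈Pos-replace (var x)    (i ∷ o) v (j ∷ P) (u , ()) o≮P P∈T′
    ∈Pos-replace (fun f ts) (i ∷ o) v (j ∷ P) o∈T o≮P P∈T′ =
      ∈Pos-replace-args ts i o j P v o∈T
        (λ { refl (r , r≢[] , e) → o≮P (r , r≢[] , cong (i ∷_) e) }) P∈T′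

    ∈Pos-replace-args : ∀ {n} (ts : Vec Term n) i o j P v → (∃ λ u → argAt ts i o ≡ just u) →
                        (i ≡ j → ¬ (o <P P)) →
                        (∃ λ w → argAt (replArg ts v i o) j P ≡ just w) → ∃ λ w → argAt ts j P ≡ just w
    ∈Pos-replace-args []       i       o j       P v _   _   (w , ())
    ∈Pos-replace-args (t ∷ ts) zero    o zero    P v o∈t o≮P P∈t′ = ∈Pos-replace t o v P o∈t (o≮P refl) P∈t′
    ∈Pos-replace-args (t ∷ ts) zero    o (suc j) P v _   _   P∈t′ = P∈t′
    ∈Pos-replace-args (t ∷ ts) (suc i) o zero    P v _   _   P∈t′ = P∈t′
    ∈Pos-replace-args (t ∷ ts) (suc i) o (suc j) P v o∈t o≮P P∈t′ =
      ∈Pos-replace-args ts i o j P v o∈t (λ e → o≮P (cong suc e)) P∈t′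

  mutual
    children-finitely-often : ∀ (s : Term) (Q : ℕ → ℕ → Set) →
      (∀ i v → s ∣ (i ∷ []) ≡ just v → Often.Fin (Q i)) →
      Often.Fin (λ m → ∃ λ i → ∃ λ v → s ∣ (i ∷ []) ≡ just v × Q i m)
    children-finitely-often (var x)    Q fin = 0 , λ { _ _ (_ , _ , () , _) }
    children-finitely-often (fun f ts) Q fin = args-finitely-often ts Q fin

    args-finitely-often : ∀ {n} (ts : Vec Term n) (Q : ℕ → ℕ → Set) →
      (∀ i v → argAt ts i [] ≡ just v → Often.Fin (Q i)) →
      Often.Fin (λ m → ∃ λ i → ∃ λ v → argAt ts i [] ≡ just v × Q i m)
    args-finitely-often []       Q fin = 0 , λ { _ _ (_ , _ , () , _) }
    args-finitely-often (t ∷ ts) Q fin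
      with fin 0 t refl Often.∪-Fin args-finitely-often ts (λ i → Q (suc i)) (λ i → fin (suc i))
    ... | N , quiet = N , λ m N≤m hit → quiet m N≤m (first-or-rest hit)
      where
      first-or-rest : ∀ {m} → (∃ λ i → ∃ λ v → argAt (t ∷ ts) i [] ≡ just v × Q i m) →
                      Q 0 m ⊎ (∃ λ i → ∃ λ v → argAt ts i [] ≡ just v × Q (suc i) m)
      first-or-rest (zero  , v , _ , Qm) = inj₁ Qm
      first-or-rest (suc i , v , e , Qm) = inj₂ (i , v , e , Qm)

  module Reductions (ℛ : TRS) (Π : PatternSet) where
    open InfSeqInCtx

    InfSeq : Term → Term → Pos → Set
    InfSeq = InfSeqInCtx ℛ Π

    Terminating : Term → Term → Pos → Set
    Terminating = ΠTerminatingIn ℛ Π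

    Minimal : Term → Term → Pos → Set
    Minimal = MinNonΠTerminatingIn ℛ Π

    coarsen : ∀ {u C u′ C′} P Q → C′ [ u′ ]at P ≡ C [ u ]at (P ++ Q) →
              InfSeq u C (P ++ Q) → InfSeq u′ C′ P
    coarsen P Q same I = record
      { seq = seq I ; pos = pos I ; steps = steps I
      ; start = trans (start I) (sym same)
      ; not-above = λ i o<P → not-above I i (<P-++ Q o<P)
      ; inf-at-below = λ n → let (m , n≤m , PQ≤o) = inf-at-below I n in m , n≤m , ++-≤P P Q PQ≤o }

    reframe : ∀ {u C u′ C′ P} → C′ [ u′ ]at P ≡ C [ u ]at P → InfSeq u C P → InfSeq u′ C′ P
    reframe {P = P} same I =
      coarsen P [] (trans same (cong (_ [ _ ]at_) (sym (++-identityʳ P))))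
        (subst (InfSeq _ _) (sym (++-identityʳ P)) I)

    suffix : ∀ {u C u′ C′ P} (I : InfSeq u C P) k → C′ [ u′ ]at P ≡ seq I k → InfSeq u′ C′ P
    suffix {P = P} I k same = record
      { seq = λ i → seq I (i + k) ; pos = λ i → pos I (i + k) ; start = sym same
      ; steps = λ i → steps I (i + k) ; not-above = λ i → not-above I (i + k)
      ; inf-at-below = later }
      where
      later : ∀ n → ∃ λ m → n ≤ m × P ≤P pos I (m + k)
      later n with inf-at-below I (n + k)
      ... | m , n+k≤m , P≤o = m ∸ k , m+n≤o⇒m≤o∸n n n+k≤m ,
            subst (λ j → P ≤P pos I j) (sym (m∸n+n≡m (≤-trans (m≤n+m k n) n+k≤m))) P≤o

    steps-before-first : ∀ {u C q} (I : InfSeq u C q) k → (∀ j → j < k → pos I j ≢ q) →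
                         _→Π*[≰_]_ ℛ Π (seq I 0) q (seq I k)
    steps-before-first I zero    _       = ε
    steps-before-first I (suc k) earlier =
      steps-before-first I k (λ j j<k → earlier j (m<n⇒m<1+n j<k)) ◅◅
      ((pos I k , ≮P∧≢⇒≰P (not-above I k) (earlier k (n<1+n k)) , steps I k) ◅ ε)

    positions-persist : ∀ {u C q} (I : InfSeq u C q) P → (∀ m → ¬ pos I m <P P) →
                        ∀ m → P ∈Pos seq I m → P ∈Pos seq I 0
    positions-persist I P below zero    P∈ = P∈
    positions-persist I P below (suc m) P∈ with steps I m
    ... | (o∈ , _) , l , r , σ , _ , _ , next =
      positions-persist I P below m
        (∈Pos-replace (seq I m) (pos I m) (r ⟨ σ ⟩) P o∈ (below m) (subst (P ∈Pos_) next P∈))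

    child-of-filler : ∀ C q s i → q ∈Pos C → (q ++ (i ∷ [])) ∈Pos (C [ s ]at q) →
                      ∃ λ v → s ∣ (i ∷ []) ≡ just v
    child-of-filler C q s i q∈C (v , e) =
      v , trans (sym (subterm-++ (C [ s ]at q) q (i ∷ []) s (fill-at C q s q∈C))) e

    step-below-child : ∀ {s C q} (I : InfSeq s C q) → (∀ m → ¬ pos I m ≤P q) → q ∈Pos C →
                       ∀ m → q ≤P pos I m →
                       ∃ λ i → ∃ λ v → s ∣ (i ∷ []) ≡ just v × (q ++ (i ∷ [])) ≤P pos I m
    step-below-child {q = q} I avoid q∈C m ([] , e) =
      ⊥-elim (avoid m (subst (_≤P q) e ([] , trans (++-identityʳ (q ++ [])) (++-identityʳ q))))
    step-below-child {s} {C} {q} I avoid q∈C m (i ∷ r , e) =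
      let qi≤o = r , trans (++-assoc q (i ∷ []) r) e
          (w , o∈) = proj₁ (proj₁ (steps I m))
          qi∈ = ∈Pos-prefix (seq I m) (q ++ (i ∷ [])) r (w , subst (λ o → seq I m ∣ o ≡ just w) (sym (proj₂ qi≤o)) o∈)
          qi∈₀ = positions-persist I (q ++ (i ∷ [])) (λ j o<qi → avoid j (<P-child⇒≤P _ q i o<qi)) m qi∈
          (v , e′) = child-of-filler C q s i q∈C (subst ((q ++ (i ∷ [])) ∈Pos_) (start I) qi∈₀)
      in i , v , e′ , qi≤o

    restrict-to-child : ∀ {s C q i v} (I : InfSeq s C q) → (∀ m → ¬ pos I m ≤P q) → q ∈Pos C →
                        s ∣ (i ∷ []) ≡ just v →
                        (∀ n → ∃ λ m → n ≤ m × (q ++ (i ∷ [])) ≤P pos I m) →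
                        InfSeq v (C [ s ]at q) (q ++ (i ∷ []))
    restrict-to-child {s} {C} {q} {i} {v} I avoid q∈C child often = record
      { seq = seq I ; pos = pos I ; steps = steps I
      ; start = trans (start I) (sym (fill-self (C [ s ]at q) (q ++ (i ∷ [])) v
                  (trans (subterm-++ (C [ s ]at q) q (i ∷ []) s (fill-at C q s q∈C)) child)))
      ; not-above = λ j o<qi → avoid j (<P-child⇒≤P _ q i o<qi)
      ; inf-at-below = often }

    module Classical (em : ExcludedMiddle 0ℓ) where
      dne : {A : Set} → ¬ ¬ A → A
      dne = em⇒dne em

      minimal-if-children-terminate : ∀ T P u → T ∣ P ≡ just u → ¬ Terminating u T P →
        (∀ i v → u ∣ (i ∷ []) ≡ just v → Terminating v T (P ++ (i ∷ []))) → Minimal u T P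
      minimal-if-children-terminate T P u at nonterm children = nonterm , proper
        where
        proper : ∀ p w → p ≢ [] → u ∣ p ≡ just w → Terminating w (T [ u ]at P) (P ++ p)
        proper []      w p≢[] _  _ = p≢[] refl
        proper (i ∷ r) w _    at′ I =
          let (v , child) = ∈Pos-prefix u (i ∷ []) r (w , at′)
              assoc = ++-assoc P (i ∷ []) r
              v-at  = trans (subterm-++ T P (i ∷ []) u at) child
              w-at  = trans (subterm-++ T P (i ∷ r) u at) at′
              same : T [ v ]at (P ++ (i ∷ [])) ≡ (T [ u ]at P) [ w ]at ((P ++ (i ∷ [])) ++ r)
              same = trans (fill-self T _ v v-at)
                       (sym (trans (cong₂ (λ X o → X [ w ]at o) (fill-self T P u at) assoc)
                                   (fill-self T (P ++ (i ∷ r)) w w-at)))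
          in children i v child (coarsen (P ++ (i ∷ [])) r same (subst (InfSeq w _) (sym assoc) I))

      -- Every non-terminating subterm contains a minimal non-terminating subterm:
      -- descend into a non-terminating child as long as there is one.
      mutual
        minimal-subterm : ∀ T P u → T ∣ P ≡ just u → ¬ Terminating u T P →
                          ∃ λ p → ∃ λ w → u ∣ p ≡ just w × Minimal w T (P ++ p)
        minimal-subterm T P u at nonterm
          with em {∃ λ i → ∃ λ v → u ∣ (i ∷ []) ≡ just v × ¬ Terminating v T (P ++ (i ∷ []))}
        minimal-subterm T P (fun f ts) at nonterm | yes (i , v , child , nonterm′)
          with minimal-subterm-arg T ts i v child (P ++ (i ∷ []))
                 (trans (subterm-++ T P (i ∷ []) _ at) child) nonterm′
        ... | p , w , at′ , minimal =
          i ∷ p , w , trans (subterm-++ (fun f ts) (i ∷ []) p v child) at′ ,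
          subst (Minimal w T) (++-assoc P (i ∷ []) p) minimal
        minimal-subterm T P u at nonterm | no none =
          [] , u , refl ,
          subst (Minimal u T) (sym (++-identityʳ P))
            (minimal-if-children-terminate T P u at nonterm
              (λ i v child nonterm′ → none (i , v , child , λ term → term nonterm′)))

        minimal-subterm-arg : ∀ T {n} (ts : Vec Term n) i v → argAt ts i [] ≡ just v →
                              ∀ P → T ∣ P ≡ just v → ¬ Terminating v T P →
                              ∃ λ p → ∃ λ w → v ∣ p ≡ just w × Minimal w T (P ++ p)
        minimal-subterm-arg T []       i       v ()
        minimal-subterm-arg T (t ∷ ts) zero    v refl = λ P → minimal-subterm T P t
        minimal-subterm-arg T (t ∷ ts) (suc i) v child = minimal-subterm-arg T ts i v child

      root-step-exists : ∀ {s C q} → q ∈Pos C →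
        (∀ p u → p ≢ [] → s ∣ p ≡ just u → Terminating u (C [ s ]at q) (q ++ p)) →
        (I : InfSeq s C q) → ∃ λ k → pos I k ≡ q
      root-step-exists {s} {C} {q} q∈C minimal I = dne λ noRoot →
        let avoid : ∀ m → ¬ pos I m ≤P q
            avoid m = ≮P∧≢⇒≰P (not-above I m) (λ root → noRoot (m , root))
            Q : ℕ → ℕ → Set
            Q i m = (q ++ (i ∷ [])) ≤P pos I m
            quiet : ∀ i v → s ∣ (i ∷ []) ≡ just v → Often.Fin (Q i)
            quiet i v child = dne λ often →
              minimal (i ∷ []) v (λ ()) child
                (restrict-to-child I avoid q∈C child
                  (λ n → dne λ none → often (n , λ m n≤m Qm → none (m , n≤m , Qm))))
            (N , silent) = children-finitely-often s Q quiet
            (m , N≤m , q≤o) = inf-at-below I N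
        in silent m N≤m (step-below-child I avoid q∈C m q≤o)

      RootStepConclusion : Term → Term → Pos → Set
      RootStepConclusion s C q = ∃[ l ] ∃[ r ] ∃[ σ ] ∃[ C′ ]
        (TRS.rules ℛ (l , r) × q ∈Pos C′ ×
         _→Π*[≰_]_ ℛ Π (C [ s ]at q) q (C′ [ l ⟨ σ ⟩ ]at q) ×
         ΠStep ℛ Π (C′ [ l ⟨ σ ⟩ ]at q) q (C′ [ r ⟨ σ ⟩ ]at q) ×
         ∃[ p ] ∃[ u ] ((r ⟨ σ ⟩) ∣ p ≡ just u ×
           Minimal u (C′ [ r ⟨ σ ⟩ ]at q) (q ++ p)))

      -- The first step of I at q yields the conclusion: the context is the term
      -- just before that step, and the remainder of I makes rσ non-terminating.
      first-root-step : ∀ {s C q} (I : InfSeq s C q) k → pos I k ≡ q →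
                        (∀ j → j < k → pos I j ≢ q) → RootStepConclusion s C q
      first-root-step {s} {C} {q} I k root earlier
        with subst (λ o → ΠStep ℛ Π (seq I k) o (seq I (suc k))) root (steps I k)
      ... | allowed , l , r , σ , rule , at-l , next =
        l , r , σ , C′ , rule , q∈C′ ,
        subst₂ (λ X Y → _→Π*[≰_]_ ℛ Π X q Y) (start I) (sym unchanged) (steps-before-first I k earlier) ,
        subst (λ X → ΠStep ℛ Π X q T) (sym unchanged) (allowed , l , r , σ , rule , at-l , refl) ,
        minimal-subterm T q (r ⟨ σ ⟩) rσ-at nonterm
        where
        C′ = seq I k
        q∈C′ = proj₁ allowed
        T = C′ [ r ⟨ σ ⟩ ]at q
        unchanged : C′ [ l ⟨ σ ⟩ ]at q ≡ C′
        unchanged = fill-self C′ q (l ⟨ σ ⟩) at-l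
        rσ-at : T ∣ q ≡ just (r ⟨ σ ⟩)
        rσ-at = fill-at C′ q (r ⟨ σ ⟩) q∈C′
        nonterm : ¬ Terminating (r ⟨ σ ⟩) T q
        nonterm term = term (reframe (fill-self T q _ rσ-at) (suffix I (suc k) (sym next)))

lemma1 : ExcludedMiddle 0ℓ →
    (F : Set) (arity : F → ℕ) (V : Set) →
    let open Rewriting F arity V in
    (ℛ : TRS) (Π : PatternSet) →
    (∀ π → Π π → Pattern.pflag π ≡ h ⊎ Pattern.pflag π ≡ b) →
    (s C : Term) (q : Pos) → q ∈Pos C →
    MinNonΠTerminatingIn ℛ Π s C q →
    ∃[ l ] ∃[ r ] ∃[ σ ] ∃[ C′ ]
    (TRS.rules ℛ (l , r) × q ∈Pos C′ ×
    _→Π*[≰_]_ ℛ Π (C [ s ]at q) q (C′ [ l ⟨ σ ⟩ ]at q) ×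
    ΠStep ℛ Π (C′ [ l ⟨ σ ⟩ ]at q) q (C′ [ r ⟨ σ ⟩ ]at q) ×
    ∃[ p ] ∃[ u ] ((r ⟨ σ ⟩) ∣ p ≡ just u ×
    MinNonΠTerminatingIn ℛ Π u (C′ [ r ⟨ σ ⟩ ]at q) (q ++ p)))
lemma1 em F arity V ℛ Π _ s C q q∈C (nonterm , minimal) =
  let (k , root , earlier) = first in first-root-step I k root earlier
  where
  open Lemmas F arity V
  open Reductions ℛ Π
  open Classical em
  open Rewriting.InfSeqInCtx using (pos)
  I : InfSeq s C q
  I = dne nonterm
  first : ∃ λ k → pos I k ≡ q × (∀ j → j < k → pos I j ≢ q)
  first = firstOccurrence (λ j → ≡-dec _≟_ (pos I j) q)
            _ (proj₂ (root-step-exists q∈C minimal I))
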